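{- Given types $A_1,\dots,A_n$, we have $[[A_1,\dots,A_n]]\le^a[[A_1],\dots,[A_n],[0^n]]$, where $0^n$ denotes $0,\dots,0$ ($n$ times).
   Context: Simply typed $\lambda$-calculus over base type $0$; every type is uniquely $[B_1,\dots,B_m]:=B_1\to\cdots\to B_m\to0$ (so $[0^n]$ is $0\to\cdots\to0\to0$ with $n$ arguments). A context $\Gamma=x_1^{C_1},\dots,x_k^{C_k}$ is a finite list of distinct typed variables, $\{\Gamma\}$ its set, $[\Gamma]:=[C_1,\dots,C_k]$; terms identified up to $\beta\eta$ ($=_{\beta\eta}$); $\Lambda^\Xi(A)$ = terms of type $A$ with free variables in $\{\Xi\}$. A substitution $\varrho$ from $\Gamma$ to $\Delta$ assigns $\varrho_c\in\Lambda^\Delta(C)$ to each $c^C\in\{\Gamma\}$; for a fresh context $\Xi$, $\varrho^\Xi$ is $\varrho$ on $\{\Gamma\}$ and the identity on $\{\Xi\}$. $\varrho$ is an atomic reduction if for every fresh $\Xi$, all $a^A,b^B\in\{\Xi,\Gamma\}$ with $A\equiv[A_1,\dots,A_n]$, $B\equiv[B_1,\dots,B_m]$, and all $M_i\in\Lambda^{\Xi,\Delta}(A_i)$, $N_i\in\Lambda^{\Xi,\Delta}(B_i)$: $\varrho^\Xi_aM_1\cdots M_n=_{\beta\eta}\varrho^\Xi_bN_1\cdots N_m$ implies $a=b$ and all $M_i=N_i$. For types, $[\Gamma]\le^a[\Delta]$ means there is an atomic reduction from the context $\Gamma$ to the context $\Delta$. -}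

module Defs where

open import Data.List using (List; []; _∷_; _++_; map; replicate; length)
open import Data.List.Relation.Unary.All using (All; []; _∷_)
open import Data.Product using (Σ; _×_)
open import Data.Unit using (⊤)

-- Simple types over the base type o (the paper's 0).
infixr 7 _⇒_
data Ty : Set where
  o   : Ty
  _⇒_ : Ty → Ty → Ty

⟦_⟧ : List Ty → Ty
⟦ [] ⟧     = o
⟦ B ∷ Bs ⟧ = B ⇒ ⟦ Bs ⟧

args : Ty → List Ty
args o       = []
args (A ⇒ B) = A ∷ args B

-- Contexts (de Bruijn: variables are positions, hence automatically distinct;
-- the head of the list is the most recently bound variable).
Ctx : Set
Ctx = List Ty

infix 4 _∋_
data _∋_ : Ctx → Ty → Set where
  here  : ∀ {Γ A} → (A ∷ Γ) ∋ A
  there : ∀ {Γ A B} → Γ ∋ A → (B ∷ Γ) ∋ A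

data Tm (Γ : Ctx) : Ty → Set where
  var : ∀ {A} → Γ ∋ A → Tm Γ A
  lam : ∀ {A B} → Tm (A ∷ Γ) B → Tm Γ (A ⇒ B)
  app : ∀ {A B} → Tm Γ (A ⇒ B) → Tm Γ A → Tm Γ B

Ren : Ctx → Ctx → Set
Ren Γ Δ = ∀ {A} → Γ ∋ A → Δ ∋ A

ext : ∀ {Γ Δ B} → Ren Γ Δ → Ren (B ∷ Γ) (B ∷ Δ)
ext ρ here      = here
ext ρ (there x) = there (ρ x)

rename : ∀ {Γ Δ} → Ren Γ Δ → ∀ {A} → Tm Γ A → Tm Δ A
rename ρ (var x)   = var (ρ x)
rename ρ (lam t)   = lam (rename (ext ρ) t)
rename ρ (app t u) = app (rename ρ t) (rename ρ u)

Sub : Ctx → Ctx → Set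
Sub Γ Δ = ∀ {A} → Γ ∋ A → Tm Δ A

exts : ∀ {Γ Δ B} → Sub Γ Δ → Sub (B ∷ Γ) (B ∷ Δ)
exts σ here      = var here
exts σ (there x) = rename there (σ x)

subst : ∀ {Γ Δ} → Sub Γ Δ → ∀ {A} → Tm Γ A → Tm Δ A
subst σ (var x)   = σ x
subst σ (lam t)   = lam (subst (exts σ) t)
subst σ (app t u) = app (subst σ t) (subst σ u)

single : ∀ {Γ A} → Tm Γ A → Sub (A ∷ Γ) Γ
single u here      = u
single u (there x) = var x

_[_] : ∀ {Γ A B} → Tm (A ∷ Γ) B → Tm Γ A → Tm Γ B
t [ u ] = subst (single u) t

infix 4 _≈_
data _≈_ {Γ : Ctx} : ∀ {A} → Tm Γ A → Tm Γ A → Set where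
  β      : ∀ {A B} (t : Tm (A ∷ Γ) B) (u : Tm Γ A) → app (lam t) u ≈ t [ u ]
  η      : ∀ {A B} (t : Tm Γ (A ⇒ B)) → t ≈ lam (app (rename there t) (var here))
  ≈-refl : ∀ {A} {t : Tm Γ A} → t ≈ t
  ≈-sym  : ∀ {A} {t u : Tm Γ A} → t ≈ u → u ≈ t
  ≈-trans : ∀ {A} {t u v : Tm Γ A} → t ≈ u → u ≈ v → t ≈ v
  lam-cong : ∀ {A B} {t t' : Tm (A ∷ Γ) B} → t ≈ t' → lam t ≈ lam t'
  app-cong : ∀ {A B} {t t' : Tm Γ (A ⇒ B)} {u u' : Tm Γ A} →
             t ≈ t' → u ≈ u' → app t u ≈ app t' u'

spine : ∀ {Γ A} → Tm Γ A → All (Tm Γ) (args A) → Tm Γ o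
spine {A = o}     t []       = t
spine {A = A ⇒ B} t (m ∷ ms) = spine (app t m) ms

_≋_ : ∀ {Γ Bs} → All (Tm Γ) Bs → All (Tm Γ) Bs → Set
[]       ≋ []       = ⊤
(m ∷ ms) ≋ (n ∷ ns) = (m ≈ n) × (ms ≋ ns)

data SameApp {Γ Δ : Ctx} : ∀ {A B} → Γ ∋ A → All (Tm Δ) (args A) →
                                   Γ ∋ B → All (Tm Δ) (args B) → Set where
  same : ∀ {A} {a : Γ ∋ A} {Ms Ns : All (Tm Δ) (args A)} →
         Ms ≋ Ns → SameApp a Ms a Ns

-- ϱ^Ξ : identity on the fresh context Ξ, ϱ on Γ
liftSub : (Ξ : Ctx) → ∀ {Γ Δ} → Sub Γ Δ → Sub (Ξ ++ Γ) (Ξ ++ Δ)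
liftSub []      σ = σ
liftSub (X ∷ Ξ) σ = exts (liftSub Ξ σ)

IsAtomic : ∀ {Γ Δ} → Sub Γ Δ → Set
IsAtomic {Γ} {Δ} ϱ =
  (Ξ : Ctx) → ∀ {A B} (a : (Ξ ++ Γ) ∋ A) (b : (Ξ ++ Γ) ∋ B)
  (Ms : All (Tm (Ξ ++ Δ)) (args A)) (Ns : All (Tm (Ξ ++ Δ)) (args B)) →
  spine (liftSub Ξ ϱ a) Ms ≈ spine (liftSub Ξ ϱ b) Ns →
  SameApp a Ms b Ns

-- [Γ] ≤ᵃ [Δ]: there is an atomic reduction from Γ = args [Γ] to Δ = args [Δ]
infix 4 _≤ᵃ_
_≤ᵃ_ : Ty → Ty → Set
A ≤ᵃ B = Σ (Sub (args A) (args B)) IsAtomic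

module Submission where

-- Take ϱ x = λ m₁ … mₙ. z (y₁ m₁) … (yₙ mₙ).  After β-reduction ϱ^Ξ x M₁ … Mₙ is the
-- variable spine z (y₁ M₁) … (yₙ Mₙ), while ϱ^Ξ u M⃗ = u M⃗ for u in Ξ.  Since z is not in Ξ
-- and the yᵢ merely record the arguments, atomicity reduces to that of the identity
-- substitution: βη-equal variable spines have the same head and βη-equal arguments.  This
-- is read off from βη-normal forms, computed by normalisation by evaluation, which is
-- complete (βη-equal terms have equal normal forms) and sound (every term is βη-equal to
-- its normal form).

open import Defs
open import Data.List using (List; []; _∷_; _++_; map; replicate; length)
open import Data.List.Relation.Unary.All as All using (All; []; _∷_)
open import Data.Product using (Σ; _×_; _,_; proj₁; proj₂)
open import Data.Unit using (tt)
open import Data.Empty using (⊥-elim)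
open import Function using (id; _∘_)
open import Relation.Nullary using (¬_)
open import Relation.Binary.PropositionalEquality
  using (_≡_; refl; sym; trans; cong; cong₂; module ≡-Reasoning)
  renaming (subst to transport)

-- Renaming and substitution

ext-cong : ∀ {Γ Δ B} {r r' : Ren Γ Δ} → (∀ {A} (x : Γ ∋ A) → r x ≡ r' x) →
  ∀ {A} (x : (B ∷ Γ) ∋ A) → ext r x ≡ ext r' x
ext-cong e here      = refl
ext-cong e (there x) = cong there (e x)

rename-cong : ∀ {Γ Δ} {r r' : Ren Γ Δ} → (∀ {A} (x : Γ ∋ A) → r x ≡ r' x) →
  ∀ {A} (t : Tm Γ A) → rename r t ≡ rename r' t
rename-cong e (var x)   = cong var (e x)
rename-cong e (lam t)   = cong lam (rename-cong (ext-cong e) t)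
rename-cong e (app t u) = cong₂ app (rename-cong e t) (rename-cong e u)

ext-∘ : ∀ {Γ Δ Θ B} (r' : Ren Δ Θ) (r : Ren Γ Δ) →
  ∀ {A} (x : (B ∷ Γ) ∋ A) → ext (r' ∘ r) x ≡ (ext r' ∘ ext r) x
ext-∘ r' r here      = refl
ext-∘ r' r (there x) = refl

rename-∘ : ∀ {Γ Δ Θ} (r' : Ren Δ Θ) (r : Ren Γ Δ) →
  ∀ {A} (t : Tm Γ A) → rename (r' ∘ r) t ≡ rename r' (rename r t)
rename-∘ r' r (var x)   = refl
rename-∘ r' r (lam t)   = cong lam (trans (rename-cong (ext-∘ r' r) t) (rename-∘ (ext r') (ext r) t))
rename-∘ r' r (app t u) = cong₂ app (rename-∘ r' r t) (rename-∘ r' r u)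

ext-id : ∀ {Γ B A} (x : (B ∷ Γ) ∋ A) → ext id x ≡ x
ext-id here      = refl
ext-id (there x) = refl

rename-id : ∀ {Γ A} (t : Tm Γ A) → rename id t ≡ t
rename-id (var x)   = refl
rename-id (lam t)   = cong lam (trans (rename-cong ext-id t) (rename-id t))
rename-id (app t u) = cong₂ app (rename-id t) (rename-id u)

exts-cong : ∀ {Γ Δ B} {σ σ' : Sub Γ Δ} → (∀ {A} (x : Γ ∋ A) → σ x ≡ σ' x) →
  ∀ {A} (x : (B ∷ Γ) ∋ A) → exts σ x ≡ exts σ' x
exts-cong e here      = refl
exts-cong e (there x) = cong (rename there) (e x)

subst-cong : ∀ {Γ Δ} {σ σ' : Sub Γ Δ} → (∀ {A} (x : Γ ∋ A) → σ x ≡ σ' x) →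
  ∀ {A} (t : Tm Γ A) → subst σ t ≡ subst σ' t
subst-cong e (var x)   = e x
subst-cong e (lam t)   = cong lam (subst-cong (exts-cong e) t)
subst-cong e (app t u) = cong₂ app (subst-cong e t) (subst-cong e u)

rename-exts : ∀ {Γ Δ Θ B} (r : Ren Δ Θ) (σ : Sub Γ Δ) →
  ∀ {A} (x : (B ∷ Γ) ∋ A) → rename (ext r) (exts σ x) ≡ exts (rename r ∘ σ) x
rename-exts r σ here      = refl
rename-exts r σ (there x) = trans (sym (rename-∘ (ext r) there (σ x))) (rename-∘ there r (σ x))

rename-subst : ∀ {Γ Δ Θ} (r : Ren Δ Θ) (σ : Sub Γ Δ) →
  ∀ {A} (t : Tm Γ A) → rename r (subst σ t) ≡ subst (rename r ∘ σ) t
rename-subst r σ (var x)   = refl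
rename-subst r σ (lam t)   =
  cong lam (trans (rename-subst (ext r) (exts σ) t) (subst-cong (rename-exts r σ) t))
rename-subst r σ (app t u) = cong₂ app (rename-subst r σ t) (rename-subst r σ u)

subst-rename : ∀ {Γ Δ Θ} (σ : Sub Δ Θ) (r : Ren Γ Δ) →
  ∀ {A} (t : Tm Γ A) → subst σ (rename r t) ≡ subst (σ ∘ r) t
subst-rename σ r (var x)   = refl
subst-rename σ r (lam t)   = cong lam (trans (subst-rename (exts σ) (ext r) t) (subst-cong exts-ext t))
  where
  exts-ext : ∀ {A} (x : _ ∋ A) → exts σ (ext r x) ≡ exts (σ ∘ r) x
  exts-ext here      = refl
  exts-ext (there x) = refl
subst-rename σ r (app t u) = cong₂ app (subst-rename σ r t) (subst-rename σ r u)

weaken : ∀ {Γ A B} → Tm Γ A → Tm (B ∷ Γ) A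
weaken = rename there

weaken-subst : ∀ {Γ Δ B A} (σ : Sub Γ Δ) (t : Tm Γ A) →
  subst (exts {B = B} σ) (weaken t) ≡ weaken (subst σ t)
weaken-subst σ t = trans (subst-rename (exts σ) there t) (sym (rename-subst there σ t))

subst-∘ : ∀ {Γ Δ Θ} (τ : Sub Δ Θ) (σ : Sub Γ Δ) →
  ∀ {A} (t : Tm Γ A) → subst τ (subst σ t) ≡ subst (subst τ ∘ σ) t
subst-∘ τ σ (var x)   = refl
subst-∘ τ σ (lam t)   = cong lam (trans (subst-∘ (exts τ) (exts σ) t) (subst-cong exts-exts t))
  where
  exts-exts : ∀ {A} (x : _ ∋ A) → subst (exts τ) (exts σ x) ≡ exts (subst τ ∘ σ) x
  exts-exts here      = refl
  exts-exts (there x) = weaken-subst τ (σ x)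
subst-∘ τ σ (app t u) = cong₂ app (subst-∘ τ σ t) (subst-∘ τ σ u)

subst-var : ∀ {Γ A} (t : Tm Γ A) → subst var t ≡ t
subst-var (var x)   = refl
subst-var (lam t)   = cong lam (trans (subst-cong exts-var t) (subst-var t))
  where
  exts-var : ∀ {A} (x : _ ∋ A) → exts var x ≡ var x
  exts-var here      = refl
  exts-var (there x) = refl
subst-var (app t u) = cong₂ app (subst-var t) (subst-var u)

rename-as-subst : ∀ {Γ Δ} (r : Ren Γ Δ) → ∀ {A} (t : Tm Γ A) → rename r t ≡ subst (var ∘ r) t
rename-as-subst r (var x)   = refl
rename-as-subst r (lam t)   = cong lam (trans (rename-as-subst (ext r) t) (subst-cong exts-var t))
  where
  exts-var : ∀ {A} (x : _ ∋ A) → var (ext r x) ≡ exts (var ∘ r) x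
  exts-var here      = refl
  exts-var (there x) = refl
rename-as-subst r (app t u) = cong₂ app (rename-as-subst r t) (rename-as-subst r u)

weaken-instantiate : ∀ {Γ A B} (t : Tm Γ A) (u : Tm Γ B) → (weaken t) [ u ] ≡ t
weaken-instantiate t u = trans (subst-rename (single u) there t) (subst-var t)

rename-instantiate : ∀ {Γ Δ A B} (r : Ren Γ Δ) (t : Tm (A ∷ Γ) B) (u : Tm Γ A) →
  rename r (t [ u ]) ≡ (rename (ext r) t) [ rename r u ]
rename-instantiate r t u =
  trans (rename-subst r (single u) t)
        (trans (subst-cong single-ext t) (sym (subst-rename (single (rename r u)) (ext r) t)))
  where
  single-ext : ∀ {C} (x : _ ∋ C) → rename r (single u x) ≡ single (rename r u) (ext r x)
  single-ext here      = refl
  single-ext (there x) = refl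

≡⇒≈ : ∀ {Γ A} {t u : Tm Γ A} → t ≡ u → t ≈ u
≡⇒≈ refl = ≈-refl

rename-≈ : ∀ {Γ Δ} (r : Ren Γ Δ) → ∀ {A} {t u : Tm Γ A} → t ≈ u → rename r t ≈ rename r u
rename-≈ r (β t u)        =
  ≈-trans (β (rename (ext r) t) (rename r u)) (≡⇒≈ (sym (rename-instantiate r t u)))
rename-≈ r (η t)          =
  ≈-trans (η (rename r t))
    (≡⇒≈ (cong (λ s → lam (app s (var here)))
               (trans (sym (rename-∘ there r t)) (rename-∘ (ext r) there t))))
rename-≈ r ≈-refl         = ≈-refl
rename-≈ r (≈-sym p)      = ≈-sym (rename-≈ r p)
rename-≈ r (≈-trans p q)  = ≈-trans (rename-≈ r p) (rename-≈ r q)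
rename-≈ r (lam-cong p)   = lam-cong (rename-≈ (ext r) p)
rename-≈ r (app-cong p q) = app-cong (rename-≈ r p) (rename-≈ r q)

spine-cong : ∀ {Γ A} {t t' : Tm Γ A} (ms : All (Tm Γ) (args A)) → t ≈ t' → spine t ms ≈ spine t' ms
spine-cong {A = o}     []       p = p
spine-cong {A = A ⇒ B} (m ∷ ms) p = spine-cong ms (app-cong p ≈-refl)

data Ne (Γ : Ctx) : Ty → Set
data Nf (Γ : Ctx) : Ty → Set

data Ne Γ where
  nvar : ∀ {A} → Γ ∋ A → Ne Γ A
  napp : ∀ {A B} → Ne Γ (A ⇒ B) → Nf Γ A → Ne Γ B

data Nf Γ where
  nne  : Ne Γ o → Nf Γ o
  nlam : ∀ {A B} → Nf (A ∷ Γ) B → Nf Γ (A ⇒ B)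

renNe : ∀ {Γ Δ} → Ren Γ Δ → ∀ {A} → Ne Γ A → Ne Δ A
renNf : ∀ {Γ Δ} → Ren Γ Δ → ∀ {A} → Nf Γ A → Nf Δ A
renNe r (nvar x)   = nvar (r x)
renNe r (napp n m) = napp (renNe r n) (renNf r m)
renNf r (nne n)    = nne (renNe r n)
renNf r (nlam m)   = nlam (renNf (ext r) m)

embNe : ∀ {Γ A} → Ne Γ A → Tm Γ A
embNf : ∀ {Γ A} → Nf Γ A → Tm Γ A
embNe (nvar x)   = var x
embNe (napp n m) = app (embNe n) (embNf m)
embNf (nne n)    = embNe n
embNf (nlam m)   = lam (embNf m)

renNe-cong : ∀ {Γ Δ} {r r' : Ren Γ Δ} → (∀ {A} (x : Γ ∋ A) → r x ≡ r' x) →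
  ∀ {A} (n : Ne Γ A) → renNe r n ≡ renNe r' n
renNf-cong : ∀ {Γ Δ} {r r' : Ren Γ Δ} → (∀ {A} (x : Γ ∋ A) → r x ≡ r' x) →
  ∀ {A} (m : Nf Γ A) → renNf r m ≡ renNf r' m
renNe-cong e (nvar x)   = cong nvar (e x)
renNe-cong e (napp n m) = cong₂ napp (renNe-cong e n) (renNf-cong e m)
renNf-cong e (nne n)    = cong nne (renNe-cong e n)
renNf-cong e (nlam m)   = cong nlam (renNf-cong (ext-cong e) m)

renNe-∘ : ∀ {Γ Δ Θ} (r' : Ren Δ Θ) (r : Ren Γ Δ) →
  ∀ {A} (n : Ne Γ A) → renNe (r' ∘ r) n ≡ renNe r' (renNe r n)
renNf-∘ : ∀ {Γ Δ Θ} (r' : Ren Δ Θ) (r : Ren Γ Δ) →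
  ∀ {A} (m : Nf Γ A) → renNf (r' ∘ r) m ≡ renNf r' (renNf r m)
renNe-∘ r' r (nvar x)   = refl
renNe-∘ r' r (napp n m) = cong₂ napp (renNe-∘ r' r n) (renNf-∘ r' r m)
renNf-∘ r' r (nne n)    = cong nne (renNe-∘ r' r n)
renNf-∘ r' r (nlam m)   = cong nlam (trans (renNf-cong (ext-∘ r' r) m) (renNf-∘ (ext r') (ext r) m))

renNe-id : ∀ {Γ A} (n : Ne Γ A) → renNe id n ≡ n
renNf-id : ∀ {Γ A} (m : Nf Γ A) → renNf id m ≡ m
renNe-id (nvar x)   = refl
renNe-id (napp n m) = cong₂ napp (renNe-id n) (renNf-id m)
renNf-id (nne n)    = cong nne (renNe-id n)
renNf-id (nlam m)   = cong nlam (trans (renNf-cong ext-id m) (renNf-id m))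

rename-embNe : ∀ {Γ Δ} (r : Ren Γ Δ) {A} (n : Ne Γ A) → rename r (embNe n) ≡ embNe (renNe r n)
rename-embNf : ∀ {Γ Δ} (r : Ren Γ Δ) {A} (m : Nf Γ A) → rename r (embNf m) ≡ embNf (renNf r m)
rename-embNe r (nvar x)   = refl
rename-embNe r (napp n m) = cong₂ app (rename-embNe r n) (rename-embNf r m)
rename-embNf r (nne n)    = rename-embNe r n
rename-embNf r (nlam m)   = cong lam (rename-embNf (ext r) m)

-- Normalisation by evaluation

Sem : Ctx → Ty → Set
Sem Γ o       = Nf Γ o
Sem Γ (A ⇒ B) = ∀ {Δ} → Ren Γ Δ → Sem Δ A → Sem Δ B

renSem : ∀ {Γ Δ} → Ren Γ Δ → ∀ {A} → Sem Γ A → Sem Δ A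
renSem r {o}     v = renNf r v
renSem r {A ⇒ B} f = λ r' → f (r' ∘ r)

reflect : ∀ {Γ} A → Ne Γ A → Sem Γ A
reify   : ∀ {Γ} A → Sem Γ A → Nf Γ A
reflect o       n = nne n
reflect (A ⇒ B) n = λ r a → reflect B (napp (renNe r n) (reify A a))
reify o       v = v
reify (A ⇒ B) f = nlam (reify B (f there (reflect A (nvar here))))

Env : Ctx → Ctx → Set
Env Γ Δ = ∀ {A} → Γ ∋ A → Sem Δ A

extEnv : ∀ {Γ Δ A} → Env Γ Δ → Sem Δ A → Env (A ∷ Γ) Δ
extEnv ρ a here      = a
extEnv ρ a (there x) = ρ x

renEnv : ∀ {Γ Δ Θ} → Ren Δ Θ → Env Γ Δ → Env Γ Θ
renEnv r ρ x = renSem r (ρ x)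

eval : ∀ {Γ Δ A} → Tm Γ A → Env Γ Δ → Sem Δ A
eval (var x)   ρ = ρ x
eval (lam t)   ρ = λ r a → eval t (extEnv (renEnv r ρ) a)
eval (app t u) ρ = eval t ρ id (eval u ρ)

idEnv : ∀ {Γ} → Env Γ Γ
idEnv {A = A} x = reflect A (nvar x)

nf : ∀ {Γ A} → Tm Γ A → Nf Γ A
nf {A = A} t = reify A (eval t idEnv)

-- Completeness

-- A Kripke partial equivalence; its reflexive part singles out the values that are natural in
-- renamings, the only ones for which evaluation behaves well.
SemEq : ∀ {Γ} A → Sem Γ A → Sem Γ A → Set
SemEq o       v w = v ≡ w
SemEq {Γ} (A ⇒ B) f g =
  (∀ {Δ} (r : Ren Γ Δ) {a b} → SemEq A a b → SemEq B (f r a) (g r b)) ×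
  (∀ {Δ Θ} (r : Ren Γ Δ) (r' : Ren Δ Θ) {a b} → SemEq A a b →
     SemEq B (renSem r' (f r a)) (g (r' ∘ r) (renSem r' b)))

renSem-resp : ∀ {Γ Δ} (r : Ren Γ Δ) A {a b} → SemEq A a b → SemEq A (renSem r a) (renSem r b)
renSem-resp r o       p = cong (renNf r) p
renSem-resp r (A ⇒ B) p = (λ r' → proj₁ p (r' ∘ r)) , (λ r' → proj₂ p (r' ∘ r))

SemEq-sym   : ∀ {Γ} A {a b : Sem Γ A} → SemEq A a b → SemEq A b a
SemEq-trans : ∀ {Γ} A {a b c : Sem Γ A} → SemEq A a b → SemEq A b c → SemEq A a c
SemEq-sym o       p = sym p
SemEq-sym (A ⇒ B) p =
  (λ r ab → SemEq-sym B (proj₁ p r (SemEq-sym A ab))) ,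
  (λ r r' ab →
    let bb = SemEq-trans A (SemEq-sym A ab) ab in
    SemEq-trans B (renSem-resp r' B (SemEq-sym B (proj₁ p r (SemEq-sym A ab))))
      (SemEq-trans B (proj₂ p r r' bb) (SemEq-sym B (proj₁ p (r' ∘ r) (renSem-resp r' A bb)))))
SemEq-trans o       p q = trans p q
SemEq-trans (A ⇒ B) p q =
  (λ r ac → SemEq-trans B (proj₁ p r (SemEq-trans A ac (SemEq-sym A ac))) (proj₁ q r ac)) ,
  (λ r r' ac → SemEq-trans B (proj₂ p r r' (SemEq-trans A ac (SemEq-sym A ac)))
                 (proj₁ q (r' ∘ r) (renSem-resp r' A ac)))

SemEq-reflˡ : ∀ {Γ} A {a b : Sem Γ A} → SemEq A a b → SemEq A a a
SemEq-reflˡ A p = SemEq-trans A p (SemEq-sym A p)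

SemEq-reflʳ : ∀ {Γ} A {a b : Sem Γ A} → SemEq A a b → SemEq A b b
SemEq-reflʳ A p = SemEq-trans A (SemEq-sym A p) p

renSem-id : ∀ {Γ} A {a : Sem Γ A} → SemEq A a a → SemEq A (renSem id a) a
renSem-id o {a} p = renNf-id a
renSem-id (A ⇒ B) p = p

renSem-∘ : ∀ {Γ Δ Θ} (r' : Ren Δ Θ) (r : Ren Γ Δ) A {a : Sem Γ A} → SemEq A a a →
  SemEq A (renSem r' (renSem r a)) (renSem (r' ∘ r) a)
renSem-∘ r' r o {a} p = sym (renNf-∘ r' r a)
renSem-∘ r' r (A ⇒ B) p = renSem-resp (r' ∘ r) (A ⇒ B) p

PointwiseEq : ∀ {Γ} A B → Sem Γ (A ⇒ B) → Sem Γ (A ⇒ B) → Set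
PointwiseEq {Γ} A B f g = ∀ {Δ} (r : Ren Γ Δ) {a b} → SemEq A a b → SemEq B (f r a) (g r b)

-- The naturality half of SemEq (A ⇒ B) f g is inherited from g.
PointwiseEq-SemEq : ∀ {Γ} A B {f g h : Sem Γ (A ⇒ B)} →
  PointwiseEq A B f g → SemEq (A ⇒ B) g h → SemEq (A ⇒ B) f h
PointwiseEq-SemEq A B fg gh =
  (λ r ab → SemEq-trans B (fg r (SemEq-reflˡ A ab)) (proj₁ gh r ab)) ,
  (λ r r' ab → SemEq-trans B (renSem-resp r' B (fg r (SemEq-reflˡ A ab))) (proj₂ gh r r' ab))

reify-resp     : ∀ {Γ} A {a b : Sem Γ A} → SemEq A a b → reify A a ≡ reify A b
reflect-refl   : ∀ {Γ} A (n : Ne Γ A) → SemEq A (reflect A n) (reflect A n)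
renNf-reify    : ∀ {Γ Δ} (r : Ren Γ Δ) A {a : Sem Γ A} → SemEq A a a →
  renNf r (reify A a) ≡ reify A (renSem r a)
renSem-reflect : ∀ {Γ Δ} (r : Ren Γ Δ) A (n : Ne Γ A) →
  SemEq A (renSem r (reflect A n)) (reflect A (renNe r n))

reflect-cong : ∀ {Γ} A {n n' : Ne Γ A} → n ≡ n' → SemEq A (reflect A n) (reflect A n')
reflect-cong A {n} refl = reflect-refl A n

reify-resp o       p = p
reify-resp (A ⇒ B) p = cong nlam (reify-resp B (proj₁ p there (reflect-refl A (nvar here))))

reflect-refl o       n = refl
reflect-refl (A ⇒ B) n =
  (λ r ab → reflect-cong B (cong (napp (renNe r n)) (reify-resp A ab))) ,
  (λ r r' {a} ab → SemEq-trans B (renSem-reflect r' B (napp (renNe r n) (reify A a)))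
      (reflect-cong B (cong₂ napp (sym (renNe-∘ r' r n))
         (trans (renNf-reify r' A (SemEq-reflˡ A ab)) (reify-resp A (renSem-resp r' A ab))))))

renNf-reify r o       p = refl
renNf-reify r (A ⇒ B) p =
  cong nlam (trans (renNf-reify (ext r) B (proj₁ p there (reflect-refl A (nvar here))))
    (trans (reify-resp B (proj₂ p there (ext r) (reflect-refl A (nvar here))))
      (reify-resp B (proj₁ p (there ∘ r) (renSem-reflect (ext r) A (nvar here))))))

renSem-reflect r o       n = refl
renSem-reflect r (A ⇒ B) n =
  PointwiseEq-SemEq A B (λ r' ab → reflect-cong B (cong₂ napp (renNe-∘ r' r n) (reify-resp A ab)))
    (reflect-refl (A ⇒ B) (renNe r n))

EnvEq : ∀ {Γ Δ} → Env Γ Δ → Env Γ Δ → Set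
EnvEq {Γ} ρ ρ' = ∀ {A} (x : Γ ∋ A) → SemEq A (ρ x) (ρ' x)

EnvEq-sym : ∀ {Γ Δ} {ρ ρ' : Env Γ Δ} → EnvEq ρ ρ' → EnvEq ρ' ρ
EnvEq-sym e {A} x = SemEq-sym A (e x)

EnvEq-reflˡ : ∀ {Γ Δ} {ρ ρ' : Env Γ Δ} → EnvEq ρ ρ' → EnvEq ρ ρ
EnvEq-reflˡ e {A} x = SemEq-reflˡ A (e x)

EnvEq-reflʳ : ∀ {Γ Δ} {ρ ρ' : Env Γ Δ} → EnvEq ρ ρ' → EnvEq ρ' ρ'
EnvEq-reflʳ e {A} x = SemEq-reflʳ A (e x)

extEnv-resp : ∀ {Γ Δ A} {ρ ρ' : Env Γ Δ} {a b : Sem Δ A} →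
  EnvEq ρ ρ' → SemEq A a b → EnvEq (extEnv ρ a) (extEnv ρ' b)
extEnv-resp e ab here      = ab
extEnv-resp e ab (there x) = e x

renEnv-resp : ∀ {Γ Δ Θ} (r : Ren Δ Θ) {ρ ρ' : Env Γ Δ} →
  EnvEq ρ ρ' → EnvEq (renEnv r ρ) (renEnv r ρ')
renEnv-resp r e {A} x = renSem-resp r A (e x)

idEnv-refl : ∀ {Γ} → EnvEq (idEnv {Γ}) idEnv
idEnv-refl {A = A} x = reflect-refl A (nvar x)

eval-resp   : ∀ {Γ Δ A} (t : Tm Γ A) {ρ ρ' : Env Γ Δ} →
  EnvEq ρ ρ' → SemEq A (eval t ρ) (eval t ρ')
renSem-eval : ∀ {Γ Δ Θ A} (t : Tm Γ A) {ρ ρ' : Env Γ Δ} → EnvEq ρ ρ' → (r : Ren Δ Θ) →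
  SemEq A (renSem r (eval t ρ)) (eval t (renEnv r ρ'))

eval-resp (var x)   e = e x
eval-resp (app t u) e = proj₁ (eval-resp t e) id (eval-resp u e)
eval-resp {A = A ⇒ B} (lam t) {ρ} {ρ'} e =
  (λ r ab → eval-resp t (extEnv-resp (renEnv-resp r e) ab)) ,
  (λ r r' ab → SemEq-trans B (renSem-eval t (extEnv-resp (renEnv-resp r e) ab) r')
                 (eval-resp t (renEnv-extEnv r r' ab)))
  where
  renEnv-extEnv : ∀ {Δ' Θ} (r : Ren _ Δ') (r' : Ren Δ' Θ) {a b : Sem Δ' A} → SemEq A a b →
    EnvEq (renEnv r' (extEnv (renEnv r ρ') b)) (extEnv (renEnv (r' ∘ r) ρ') (renSem r' b))
  renEnv-extEnv r r' ab here          = renSem-resp r' A (SemEq-reflʳ A ab)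
  renEnv-extEnv r r' ab {C} (there x) = renSem-∘ r' r C (EnvEq-reflʳ e x)

renSem-eval {A = A} (var x) e r = renSem-resp r A (e x)
renSem-eval {A = B} (app t u) e r =
  SemEq-trans B (proj₂ (eval-resp t (EnvEq-reflˡ e)) id r (eval-resp u (EnvEq-reflˡ e)))
                (proj₁ (renSem-eval t e r) id (renSem-eval u e r))
renSem-eval {A = A ⇒ B} (lam t) {ρ} e r =
  PointwiseEq-SemEq A B (λ r' ab → eval-resp t (extEnv-resp renEnv-∘ ab))
    (eval-resp (lam t) (renEnv-resp r e))
  where
  renEnv-∘ : ∀ {Θ'} {r' : Ren _ Θ'} → EnvEq (renEnv (r' ∘ r) ρ) (renEnv r' (renEnv r ρ))
  renEnv-∘ {r' = r'} {C} x = SemEq-sym C (renSem-∘ r' r C (EnvEq-reflˡ e x))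

eval-rename : ∀ {Γ Γ' Δ A} (w : Ren Γ Γ') (t : Tm Γ A) {ρ : Env Γ' Δ} {ρ' : Env Γ Δ} →
  (∀ {C} (x : Γ ∋ C) → SemEq C (ρ (w x)) (ρ' x)) → SemEq A (eval (rename w t) ρ) (eval t ρ')
eval-rename w (var x)   e = e x
eval-rename w (app t u) e = proj₁ (eval-rename w t e) id (eval-rename w u e)
eval-rename {A = A ⇒ B} w (lam t) {ρ} {ρ'} e =
  PointwiseEq-SemEq A B (λ r ab → eval-rename (ext w) t (extEnv-ext r ab))
    (eval-resp (lam t) (λ {C} x → SemEq-reflʳ C (e x)))
  where
  extEnv-ext : ∀ {Δ'} (r : Ren _ Δ') {a b} → SemEq A a b → ∀ {C} (x : (A ∷ _) ∋ C) →
    SemEq C (extEnv (renEnv r ρ) a (ext w x)) (extEnv (renEnv r ρ') b x)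
  extEnv-ext r ab here          = ab
  extEnv-ext r ab {C} (there x) = renSem-resp r C (e x)

eval-subst : ∀ {Γ Γ' Δ A} (σ : Sub Γ Γ') (t : Tm Γ A) {ρ : Env Γ' Δ} {ρ' : Env Γ Δ} →
  EnvEq ρ ρ →
  (∀ {C} (x : Γ ∋ C) → SemEq C (eval (σ x) ρ) (ρ' x)) → SemEq A (eval (subst σ t) ρ) (eval t ρ')
eval-subst σ (var x)   ρρ e = e x
eval-subst σ (app t u) ρρ e = proj₁ (eval-subst σ t ρρ e) id (eval-subst σ u ρρ e)
eval-subst {A = A ⇒ B} σ (lam t) {ρ} {ρ'} ρρ e =
  PointwiseEq-SemEq A B
    (λ r ab → eval-subst (exts σ) t (extEnv-resp (renEnv-resp r ρρ) (SemEq-reflˡ A ab))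
                         (extEnv-exts r ab))
    (eval-resp (lam t) (λ {C} x → SemEq-reflʳ C (e x)))
  where
  extEnv-exts : ∀ {Δ'} (r : Ren _ Δ') {a b} → SemEq A a b → ∀ {C} (x : (A ∷ _) ∋ C) →
    SemEq C (eval (exts σ x) (extEnv (renEnv r ρ) a)) (extEnv (renEnv r ρ') b x)
  extEnv-exts r ab here          = ab
  extEnv-exts r ab {C} (there x) =
    SemEq-trans C (eval-rename there (σ x) (λ {D} y → renSem-resp r D (ρρ y)))
      (SemEq-trans C (SemEq-sym C (renSem-eval (σ x) ρρ r)) (renSem-resp r C (e x)))

eval-≈ : ∀ {Γ Δ A} {t u : Tm Γ A} → t ≈ u →
  {ρ ρ' : Env Γ Δ} → EnvEq ρ ρ' → SemEq A (eval t ρ) (eval u ρ')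
eval-≈ {A = B} (β {A} t u) {ρ} {ρ'} e =
  SemEq-trans B (eval-resp t extEnv-id) (SemEq-sym B (eval-subst (single u) t (EnvEq-reflʳ e) single-extEnv))
  where
  extEnv-id : EnvEq (extEnv (renEnv id ρ) (eval u ρ)) (extEnv ρ' (eval u ρ'))
  extEnv-id here          = eval-resp u e
  extEnv-id {D} (there x) = SemEq-trans D (renSem-id D (EnvEq-reflˡ e x)) (e x)
  single-extEnv : ∀ {D} (x : (A ∷ _) ∋ D) → SemEq D (eval (single u x) ρ') (extEnv ρ' (eval u ρ') x)
  single-extEnv here      = eval-resp u (EnvEq-reflʳ e)
  single-extEnv (there x) = EnvEq-reflʳ e x
eval-≈ {A = A ⇒ B} (η t) {ρ} {ρ'} e =
  SemEq-sym (A ⇒ B) (PointwiseEq-SemEq A B η-pointwise (eval-resp t (EnvEq-sym e)))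
  where
  η-pointwise : PointwiseEq A B (eval (lam (app (rename there t) (var here))) ρ') (eval t ρ')
  η-pointwise r ab =
    SemEq-trans B
      (proj₁ (eval-rename there t (λ {D} x → renSem-resp r D (EnvEq-reflʳ e x))) id (SemEq-reflˡ A ab))
                  (proj₁ (SemEq-sym (A ⇒ B) (renSem-eval t (EnvEq-reflʳ e) r)) id ab)
eval-≈ {t = t} ≈-refl e       = eval-resp t e
eval-≈ {A = A} (≈-sym p) e     = SemEq-sym A (eval-≈ p (EnvEq-sym e))
eval-≈ {A = A} (≈-trans p q) e = SemEq-trans A (eval-≈ p (EnvEq-reflˡ e)) (eval-≈ q e)
eval-≈ {A = A ⇒ B} (lam-cong {t' = t'} p) e =
  PointwiseEq-SemEq A B (λ r ab → eval-≈ p (extEnv-resp (renEnv-resp r e) ab))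
    (eval-resp (lam t') (EnvEq-reflʳ e))
eval-≈ (app-cong p q) e = proj₁ (eval-≈ p e) id (eval-≈ q e)

completeness : ∀ {Γ A} {t u : Tm Γ A} → t ≈ u → nf t ≡ nf u
completeness {A = A} p = reify-resp A (eval-≈ p idEnv-refl)

-- Soundness

infix 4 _®_
_®_ : ∀ {Γ A} → Tm Γ A → Sem Γ A → Set
_®_ {A = o}         t v = t ≈ embNf v
_®_ {Γ} {A = A ⇒ B} t f = ∀ {Δ} (r : Ren Γ Δ) {u a} → u ® a → app (rename r t) u ® f r a

®-≈ : ∀ {Γ A} {t t' : Tm Γ A} {v} → t ≈ t' → t ® v → t' ® v
®-≈ {A = o}     p q      = ≈-trans (≈-sym p) q
®-≈ {A = A ⇒ B} p q r ua = ®-≈ (app-cong (rename-≈ r p) ≈-refl) (q r ua)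

®-rename : ∀ {Γ Δ} (r : Ren Γ Δ) {A t v} → _®_ {A = A} t v → rename r t ® renSem r v
®-rename r {o} {v = v} p = ≈-trans (rename-≈ r p) (≡⇒≈ (rename-embNf r v))
®-rename r {A ⇒ B} {t} p r' ua = ®-≈ (app-cong (≡⇒≈ (rename-∘ r' r t)) ≈-refl) (p (r' ∘ r) ua)

reify-® : ∀ {Γ} A {t : Tm Γ A} {v} → t ® v → t ≈ embNf (reify A v)
reflect-® : ∀ {Γ} A (n : Ne Γ A) → embNe n ® reflect A n
reify-® o       p = p
reify-® (A ⇒ B) {t} p = ≈-trans (η t) (lam-cong (reify-® B (p there (reflect-® A (nvar here)))))
reflect-® o       n = ≈-refl
reflect-® (A ⇒ B) n r {u} {a} ua =
  ®-≈ (app-cong (≡⇒≈ (sym (rename-embNe r n))) (≈-sym (reify-® A ua)))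
      (reflect-® B (napp (renNe r n) (reify A a)))

fundamental : ∀ {Γ Δ A} (t : Tm Γ A) (σ : Sub Γ Δ) (ρ : Env Γ Δ) →
  (∀ {C} (x : Γ ∋ C) → σ x ® ρ x) → subst σ t ® eval t ρ
fundamental (var x)   σ ρ h = h x
fundamental (app t u) σ ρ h =
  ®-≈ (app-cong (≡⇒≈ (rename-id (subst σ t))) ≈-refl)
      (fundamental t σ ρ h id (fundamental u σ ρ h))
fundamental {A = A ⇒ B} (lam t) σ ρ h r {u} {a} ua =
  ®-≈ (≈-sym (≈-trans (β _ u) (≡⇒≈ β-result))) (fundamental t σ' (extEnv (renEnv r ρ) a) σ'®)
  where
  σ' : Sub (A ∷ _) _
  σ' here      = u
  σ' (there x) = rename r (σ x)
  σ'® : ∀ {C} (x : (A ∷ _) ∋ C) → σ' x ® extEnv (renEnv r ρ) a x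
  σ'® here      = ua
  σ'® (there x) = ®-rename r (h x)
  σ'-exts : ∀ {C} (x : (A ∷ _) ∋ C) → subst (single u ∘ ext r) (exts σ x) ≡ σ' x
  σ'-exts here      = refl
  σ'-exts (there x) = trans (subst-rename (single u ∘ ext r) there (σ x)) (sym (rename-as-subst r (σ x)))
  β-result : (rename (ext r) (subst (exts σ) t)) [ u ] ≡ subst σ' t
  β-result = trans (subst-rename (single u) (ext r) (subst (exts σ) t))
               (trans (subst-∘ _ (exts σ) t) (subst-cong σ'-exts t))

soundness : ∀ {Γ A} (t : Tm Γ A) → t ≈ embNf (nf t)
soundness {A = A} t =
  reify-® A (®-≈ (≡⇒≈ (subst-var t)) (fundamental t var idEnv (λ {C} x → reflect-® C (nvar x))))

-- Variable spines are atomic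

appSem : ∀ {Γ} A → Sem Γ A → All (Sem Γ) (args A) → Sem Γ o
appSem o       v []       = v
appSem (A ⇒ B) f (a ∷ as) = appSem B (f id a) as

nspine : ∀ {Γ} A → Ne Γ A → All (Nf Γ) (args A) → Ne Γ o
nspine o       n []       = n
nspine (A ⇒ B) n (m ∷ ms) = nspine B (napp n m) ms

eval-spine : ∀ {Γ Δ A} (t : Tm Γ A) (ms : All (Tm Γ) (args A)) (ρ : Env Γ Δ) →
  eval (spine t ms) ρ ≡ appSem A (eval t ρ) (All.map (λ m → eval m ρ) ms)
eval-spine {A = o}     t []       ρ = refl
eval-spine {A = A ⇒ B} t (m ∷ ms) ρ = eval-spine (app t m) ms ρ

appSem-reflect : ∀ {Γ} A (n : Ne Γ A) (ms : All (Tm Γ) (args A)) →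
  appSem A (reflect A n) (All.map (λ m → eval m idEnv) ms) ≡ nne (nspine A n (All.map nf ms))
appSem-reflect o       n []       = refl
appSem-reflect (A ⇒ B) n (m ∷ ms) =
  trans (appSem-reflect B (napp (renNe id n) (nf m)) ms)
        (cong (λ n' → nne (nspine B (napp n' (nf m)) (All.map nf ms))) (renNe-id n))

nf-var-spine : ∀ {Γ A} (v : Γ ∋ A) (ms : All (Tm Γ) (args A)) →
  nf (spine (var v) ms) ≡ nne (nspine A (nvar v) (All.map nf ms))
nf-var-spine {A = A} v ms = trans (eval-spine (var v) ms idEnv) (appSem-reflect A (nvar v) ms)

nf-injective : ∀ {Γ A} {t u : Tm Γ A} → nf t ≡ nf u → t ≈ u
nf-injective {t = t} {u} e =
  ≈-trans (soundness t) (≈-trans (≡⇒≈ (cong embNf e)) (≈-sym (soundness u)))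

map-nf-injective : ∀ {Γ As} {ms ns : All (Tm Γ) As} → All.map nf ms ≡ All.map nf ns → ms ≋ ns
map-nf-injective {ms = []}     {[]}     e = tt
map-nf-injective {ms = m ∷ ms} {n ∷ ns} e =
  nf-injective (cong All.head e) , map-nf-injective (cong All.tail e)

nne-injective : ∀ {Γ} {n n' : Ne Γ o} → nne n ≡ nne n' → n ≡ n'
nne-injective refl = refl

Head : Ctx → Set
Head Γ = Σ Ty λ A → Γ ∋ A × All (Nf Γ) (args A)

flatten : ∀ {Γ C} → Ne Γ C → All (Nf Γ) (args C) → Head Γ
flatten {C = C} (nvar v) ms = C , v , ms
flatten (napp n m)       ms = flatten n (m ∷ ms)

flatten-nspine : ∀ {Γ} C (n : Ne Γ C) (ms : All (Nf Γ) (args C)) →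
  flatten (nspine C n ms) [] ≡ flatten n ms
flatten-nspine o       n []       = refl
flatten-nspine (A ⇒ B) n (m ∷ ms) = flatten-nspine B (napp n m) ms

-- The argument lists are related by an equation instead of being identified, so that matching
-- on same-head still succeeds when they are not variables.
data SameHead {Γ : Ctx} : ∀ {A B} →
  Γ ∋ A → All (Nf Γ) (args A) → Γ ∋ B → All (Nf Γ) (args B) → Set where
  same-head : ∀ {A} {v : Γ ∋ A} {ms ns} → ms ≡ ns → SameHead v ms v ns

nspine-injective : ∀ {Γ A B} {v : Γ ∋ A} {w : Γ ∋ B} {ms ns} →
  nspine A (nvar v) ms ≡ nspine B (nvar w) ns → SameHead v ms w ns
nspine-injective {A = A} {B} {v} {w} {ms} {ns} e =
  Head-≡ (trans (sym (flatten-nspine A (nvar v) ms))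
         (trans (cong (λ n → flatten n []) e) (flatten-nspine B (nvar w) ns)))
  where
  Head-≡ : _≡_ {A = Head _} (A , v , ms) (B , w , ns) → SameHead v ms w ns
  Head-≡ refl = same-head refl

var-spine-atomic : ∀ {Γ A B} {v : Γ ∋ A} {w : Γ ∋ B} {Ms Ns} →
  spine (var v) Ms ≈ spine (var w) Ns → SameApp v Ms w Ns
var-spine-atomic {v = v} {w} {Ms} {Ns} p =
  SameHead⇒SameApp (nspine-injective (nne-injective (begin
    nne (nspine _ (nvar v) (All.map nf Ms)) ≡⟨ sym (nf-var-spine v Ms) ⟩
    nf (spine (var v) Ms)                   ≡⟨ completeness p ⟩
    nf (spine (var w) Ns)                   ≡⟨ nf-var-spine w Ns ⟩
    nne (nspine _ (nvar w) (All.map nf Ns)) ∎)))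
  where
  open ≡-Reasoning
  SameHead⇒SameApp : SameHead v (All.map nf Ms) w (All.map nf Ns) → SameApp v Ms w Ns
  SameHead⇒SameApp (same-head e) = same (map-nf-injective e)

injL : ∀ {Γ} (Ξ : Ctx) {A} → Ξ ∋ A → (Ξ ++ Γ) ∋ A
injL (X ∷ Ξ) here      = here
injL (X ∷ Ξ) (there u) = there (injL Ξ u)

injR : ∀ {Γ} (Ξ : Ctx) {A} → Γ ∋ A → (Ξ ++ Γ) ∋ A
injR []      x = x
injR (X ∷ Ξ) x = there (injR Ξ x)

data View (Ξ Γ : Ctx) {A : Ty} : (Ξ ++ Γ) ∋ A → Set where
  isL : (u : Ξ ∋ A) → View Ξ Γ (injL Ξ u)
  isR : (x : Γ ∋ A) → View Ξ Γ (injR Ξ x)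

view : ∀ {Γ} (Ξ : Ctx) {A} (v : (Ξ ++ Γ) ∋ A) → View Ξ Γ v
view []      v         = isR v
view (X ∷ Ξ) here      = isL here
view (X ∷ Ξ) (there v) with view Ξ v
... | isL u = isL (there u)
... | isR x = isR x

liftSub-injL : ∀ (Ξ : Ctx) {Γ Δ} (σ : Sub Γ Δ) {A} (u : Ξ ∋ A) →
  liftSub Ξ σ (injL Ξ u) ≡ var (injL Ξ u)
liftSub-injL (X ∷ Ξ) σ here      = refl
liftSub-injL (X ∷ Ξ) σ (there u) = cong (rename there) (liftSub-injL Ξ σ u)

liftSub-injR : ∀ (Ξ : Ctx) {Γ Δ} (σ : Sub Γ Δ) {A} (x : Γ ∋ A) →
  liftSub Ξ σ (injR Ξ x) ≡ rename (injR Ξ) (σ x)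
liftSub-injR []      σ x = sym (rename-id (σ x))
liftSub-injR (X ∷ Ξ) σ x =
  trans (cong (rename there) (liftSub-injR Ξ σ x)) (sym (rename-∘ there (injR Ξ) (σ x)))

SameApp-map : ∀ {Γ Γ' Δ A B} (r : Ren Γ Γ') {a : Γ ∋ A} {b : Γ ∋ B} {Ms Ns} →
  SameApp {Γ} {Δ} a Ms b Ns → SameApp (r a) Ms (r b) Ns
SameApp-map r (same p) = same p

SameApp-there : ∀ {Γ Δ A B C} {a : Γ ∋ A} {b : Γ ∋ B} {Ms Ns} →
  SameApp {C ∷ Γ} {Δ} (there a) Ms (there b) Ns → SameApp a Ms b Ns
SameApp-there (same p) = same p

SameApp-injL : ∀ {Γ Δ} (Ξ : Ctx) {A B} {u : Ξ ∋ A} {u' : Ξ ∋ B} {Ms Ns} →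
  SameApp {Ξ ++ Γ} {Δ} (injL Ξ u) Ms (injL Ξ u') Ns → SameApp u Ms u' Ns
SameApp-injL (X ∷ Ξ) {u = here}    {here}     (same p) = same p
SameApp-injL (X ∷ Ξ) {u = there u} {there u'} s        =
  SameApp-map there (SameApp-injL Ξ (SameApp-there s))

injL-injR-apart : ∀ {Γ Δ} (Ξ : Ctx) {A B} {u : Ξ ∋ A} {x : Γ ∋ B} {Ms Ns} →
  ¬ SameApp {Ξ ++ Γ} {Δ} (injL Ξ u) Ms (injR Ξ x) Ns
injL-injR-apart (X ∷ Ξ) {u = here}    ()
injL-injR-apart (X ∷ Ξ) {u = there u} s = injL-injR-apart Ξ (SameApp-there s)

SameApp-args : ∀ {Γ Δ A} {a : Γ ∋ A} {Ms Ns : All (Tm Δ) (args A)} → SameApp a Ms a Ns → Ms ≋ Ns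
SameApp-args (same p) = p

-- The atomic reduction

Ys : List Ty → Ctx
Ys = map (_⇒ o)

Zt : List Ty → Ty
Zt As = ⟦ replicate (length As) o ⟧

-- relay Bs ys h is the term λ m₁ … mₙ. h (y₁ m₁) … (yₙ mₙ).
relay : (Bs : List Ty) → ∀ {Θ} → Sub (Ys Bs) Θ → Tm Θ (Zt Bs) → Tm Θ ⟦ Bs ⟧
relay []       ys h = h
relay (B ∷ Bs) ys h =
  lam (relay Bs (weaken ∘ ys ∘ there) (app (weaken h) (app (weaken (ys here)) (var here))))

zipApp : ∀ {Bs Θ} → Sub (Ys Bs) Θ → All (Tm Θ) (args ⟦ Bs ⟧) → All (Tm Θ) (args (Zt Bs))
zipApp {[]}     ys []       = []
zipApp {B ∷ Bs} ys (m ∷ ms) = app (ys here) m ∷ zipApp (ys ∘ there) ms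

relay-cong : ∀ (Bs : List Ty) {Θ} {ys ys' : Sub (Ys Bs) Θ} {h h'} →
  (∀ {C} (y : Ys Bs ∋ C) → ys y ≡ ys' y) → h ≡ h' → relay Bs ys h ≡ relay Bs ys' h'
relay-cong []       e refl = refl
relay-cong (B ∷ Bs) e refl =
  cong lam (relay-cong Bs (cong weaken ∘ e ∘ there)
                          (cong (λ y → app _ (app (weaken y) (var here))) (e here)))

subst-relay : ∀ (Bs : List Ty) {Θ Θ'} (σ : Sub Θ Θ') (ys : Sub (Ys Bs) Θ) (h : Tm Θ (Zt Bs)) →
  subst σ (relay Bs ys h) ≡ relay Bs (subst σ ∘ ys) (subst σ h)
subst-relay []       σ ys h = refl
subst-relay (B ∷ Bs) σ ys h =
  cong lam (trans (subst-relay Bs (exts σ) _ _)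
                  (relay-cong Bs (weaken-subst σ ∘ ys ∘ there)
                     (cong₂ (λ h' y → app h' (app y (var here)))
                            (weaken-subst σ h) (weaken-subst σ (ys here)))))

relay-apply : ∀ (B : Ty) (Bs : List Ty) {Θ} (ys : Sub (Ys (B ∷ Bs)) Θ) (h : Tm Θ (Zt (B ∷ Bs)))
  (M : Tm Θ B) →
  app (relay (B ∷ Bs) ys h) M ≈ relay Bs (ys ∘ there) (app h (app (ys here) M))
relay-apply B Bs ys h M =
  ≈-trans (β _ M)
    (≡⇒≈ (trans (subst-relay Bs (single M) _ _)
                (relay-cong Bs (λ y → weaken-instantiate (ys (there y)) M)
                   (cong₂ (λ h' y → app h' (app y M))
                          (weaken-instantiate h M) (weaken-instantiate (ys here) M)))))

relay-β : ∀ (Bs : List Ty) {Θ} (ys : Sub (Ys Bs) Θ) (h : Tm Θ (Zt Bs))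
  (Ms : All (Tm Θ) (args ⟦ Bs ⟧)) →
  spine (relay Bs ys h) Ms ≈ spine h (zipApp ys Ms)
relay-β []       ys h []       = ≈-refl
relay-β (B ∷ Bs) ys h (M ∷ Ms) =
  ≈-trans (spine-cong Ms (relay-apply B Bs ys h M)) (relay-β Bs (ys ∘ there) (app h (app (ys here) M)) Ms)

zipApp-var-injective : ∀ {Bs Θ} (r : Ren (Ys Bs) Θ) {Ms Ns : All (Tm Θ) (args ⟦ Bs ⟧)} →
  zipApp (var ∘ r) Ms ≋ zipApp (var ∘ r) Ns → Ms ≋ Ns
zipApp-var-injective {[]}     r {[]}     {[]}     _        = tt
zipApp-var-injective {B ∷ Bs} r {M ∷ Ms} {N ∷ Ns} (p , ps) =
  proj₁ (SameApp-args (var-spine-atomic {Ms = M ∷ []} {N ∷ []} p)) , zipApp-var-injective (r ∘ there) ps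

-- The context y₁ : [A₁], …, yₙ : [Aₙ], z : [0ⁿ].
Target : List Ty → Ctx
Target As = Ys As ++ Zt As ∷ []

y : (As : List Ty) → Ren (Ys As) (Target As)
y As = injL (Ys As)

z : (As : List Ty) → Target As ∋ Zt As
z As = injR (Ys As) here

ϱ : (As : List Ty) → Sub (⟦ As ⟧ ∷ []) (Target As)
ϱ As here = relay As (var ∘ y As) (var (z As))

module _ (As : List Ty) (Ξ : Ctx) where

  ϱΞ-injL : ∀ {A} (u : Ξ ∋ A) Ms →
    spine (liftSub Ξ (ϱ As) (injL Ξ u)) Ms ≈ spine (var (injL Ξ u)) Ms
  ϱΞ-injL u Ms = ≡⇒≈ (cong (λ t → spine t Ms) (liftSub-injL Ξ (ϱ As) u))

  ϱΞ-x : ∀ Ms →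
    spine (liftSub Ξ (ϱ As) (injR Ξ here)) Ms ≈
    spine (var (injR Ξ (z As))) (zipApp (var ∘ injR Ξ ∘ y As) Ms)
  ϱΞ-x Ms =
    ≈-trans (≡⇒≈ (cong (λ t → spine t Ms)
               (trans (liftSub-injR Ξ (ϱ As) here)
               (trans (rename-as-subst (injR Ξ) (ϱ As here))
                      (subst-relay As (var ∘ injR Ξ) (var ∘ y As) (var (z As)))))))
            (relay-β As (var ∘ injR Ξ ∘ y As) (var (injR Ξ (z As))) Ms)

spines-atomic : ∀ {Γ C D} {s t : Tm Γ o} {v : Γ ∋ C} {w : Γ ∋ D} {Ms Ns} →
  s ≈ spine (var v) Ms → t ≈ spine (var w) Ns → s ≈ t → SameApp v Ms w Ns
spines-atomic p q s≈t = var-spine-atomic (≈-trans (≈-sym p) (≈-trans s≈t q))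

ϱ-atomic : (As : List Ty) → IsAtomic (ϱ As)
ϱ-atomic As Ξ a b Ms Ns H with view Ξ a | view Ξ b
... | isL u    | isL u'   =
  SameApp-map (injL Ξ) (SameApp-injL Ξ {u = u} {u' = u'}
    (spines-atomic (ϱΞ-injL As Ξ u Ms) (ϱΞ-injL As Ξ u' Ns) H))
... | isL u    | isR here =
  ⊥-elim (injL-injR-apart Ξ {u = u} {x = z As}
    (spines-atomic (ϱΞ-injL As Ξ u Ms) (ϱΞ-x As Ξ Ns) H))
... | isR here | isL u'   =
  ⊥-elim (injL-injR-apart Ξ {u = u'} {x = z As}
    (spines-atomic (ϱΞ-injL As Ξ u' Ns) (ϱΞ-x As Ξ Ms) (≈-sym H)))
... | isR here | isR here =
  same (zipApp-var-injective _ (SameApp-args (spines-atomic (ϱΞ-x As Ξ Ms) (ϱΞ-x As Ξ Ns) H)))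

args-⟦⟧ : (Bs : List Ty) → args ⟦ Bs ⟧ ≡ Bs
args-⟦⟧ []       = refl
args-⟦⟧ (B ∷ Bs) = cong (B ∷_) (args-⟦⟧ Bs)

lemmaL : (As : List Ty) →
    ⟦ ⟦ As ⟧ ∷ [] ⟧ ≤ᵃ ⟦ map (λ A → ⟦ A ∷ [] ⟧) As ++ ⟦ replicate (length As) o ⟧ ∷ [] ⟧
lemmaL As =
  transport (λ Δ → Σ (Sub (⟦ As ⟧ ∷ []) Δ) IsAtomic) (sym (args-⟦⟧ (Target As)))
            (ϱ As , ϱ-atomic As)
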